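{- The theory of connected ramified sets recognizes coordinates.
   Context: A ramified set is a partially ordered set $(L,\le)$ in which the set of predecessors of every element is linearly ordered; it is connected if every two elements $x,y$ have a common lower bound $z\le x$, $z\le y$. The theory of connected ramified sets is the first-order theory in the language with one binary relation $\le$ axiomatizing these properties. An ideal $\mathcal I$ on $\mathbb N$ is atomless if $\mathcal P(\mathbb N)/\mathcal I$ is atomless. For structures $\mathcal M_n$ and an ideal $\mathcal I$, $\prod_n\mathcal M_n/\mathcal I$ is the set of classes of $\prod_n\mathcal M_n$ under $a\sim b\iff\{n:a(n)\ne b(n)\}\in\mathcal I$, with $a\le b$ iff $\{n:\neg(\tilde a(n)\le\tilde b(n))\}\in\mathcal I$. For $S\subseteq\mathbb N$, $a=_S b$ means $\{n\in S:\tilde a(n)\ne\tilde b(n)\}\in\mathcal I$ (depends only on $[S]\in\mathcal P(\mathbb N)/\mathcal I$). A function $\Phi\colon\prod_n\mathcal M_n/\mathcal I\to\prod_n\mathcal N_n/\mathcal J$ is (isomorphically) coordinate-respecting if there is a Boolean algebra isomorphism $\alpha\colon\mathcal P(\mathbb N)/\mathcal I\to\mathcal P(\mathbb N)/\mathcal J$ such that $a=_S b$ implies $\Phi(a)=_{\alpha(S)}\Phi(b)$. A first-order theory $T$ recognizes coordinates if for all atomless ideals $\mathcal I,\mathcal J$ and all models $\mathcal M_n,\mathcal N_n$ of $T$ each with at least two elements, every isomorphism $\prod_n\mathcal M_n/\mathcal I\to\prod_n\mathcal N_n/\mathcal J$ is (isomorphically) coordinate-respecting. -}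

module Defs where

open import Level using (0ℓ)
open import Data.Nat using (ℕ)
open import Data.Product using (Σ; ∃; ∃-syntax; _×_; _,_)
open import Data.Sum using (_⊎_)
open import Relation.Nullary using (¬_)
open import Relation.Binary.PropositionalEquality using (_≡_; _≢_)
open import Relation.Unary using (Pred; _⊆_; _∪_; _∩_; ∁; ∅; U)

-- Structures in the language with one binary relation symbol ≤.
-- Equality of the first-order language is interpreted as _≡_.

record Structure : Set₁ where
  field
    Carrier : Set
    _≤_     : Carrier → Carrier → Set

open Structure public

record IsConnectedRamifiedSet (M : Structure) : Set where
  private
    A = Carrier M
    _≼_ = _≤_ M
  field
    refl′    : ∀ (x : A) → x ≼ x
    trans′   : ∀ {x y z : A} → x ≼ y → y ≼ z → x ≼ z
    antisym′ : ∀ {x y : A} → x ≼ y → y ≼ x → x ≡ y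
    ramified : ∀ {x y z : A} → y ≼ x → z ≼ x → (y ≼ z) ⊎ (z ≼ y)
    connected : ∀ (x y : A) → ∃[ z ] (z ≼ x × z ≼ y)

AtLeastTwo : Structure → Set
AtLeastTwo M = ∃[ x ] ∃[ y ] (_≢_ {A = Carrier M} x y)

Subset : Set₁
Subset = Pred ℕ 0ℓ

_∖_ : Subset → Subset → Subset
S ∖ T = S ∩ ∁ T

record IsIdeal (I : Pred Subset 0ℓ) : Set₁ where
  field
    has-∅    : I ∅
    downward : ∀ {S T : Subset} → S ⊆ T → I T → I S
    unions   : ∀ {S T : Subset} → I S → I T → I (S ∪ T)
    proper   : ¬ I U

-- Equality in P(ℕ)/I :  [S] = [T]  iff  S Δ T ∈ I
_≈[_]_ : Subset → Pred Subset 0ℓ → Subset → Set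
S ≈[ I ] T = I (S ∖ T) × I (T ∖ S)

-- Order in P(ℕ)/I :  [S] ≤ [T]  iff  S ∖ T ∈ I
_⊑[_]_ : Subset → Pred Subset 0ℓ → Subset → Set
S ⊑[ I ] T = I (S ∖ T)

IsAtom : Pred Subset 0ℓ → Subset → Set₁
IsAtom I S = ¬ I S × (∀ (T : Subset) → T ⊑[ I ] S → I T ⊎ (T ≈[ I ] S))

Atomless : Pred Subset 0ℓ → Set₁
Atomless I = ∀ (S : Subset) → ¬ IsAtom I S

-- A Boolean algebra isomorphism P(ℕ)/I → P(ℕ)/J, given on representatives:
-- well defined, preserves joins and complements, bijective.
record IsBoolIso (I J : Pred Subset 0ℓ) (α : Subset → Subset) : Set₁ where
  field
    wd         : ∀ {S T} → S ≈[ I ] T → α S ≈[ J ] α T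
    pres-∪     : ∀ S T → α (S ∪ T) ≈[ J ] (α S ∪ α T)
    pres-∁     : ∀ S → α (∁ S) ≈[ J ] ∁ (α S)
    injective  : ∀ {S T} → α S ≈[ J ] α T → S ≈[ I ] T
    surjective : ∀ T → ∃[ S ] (α S ≈[ J ] T)

-- Reduced products ∏ₙ Mₙ / I, as a setoid on representatives.

Prod : (ℕ → Structure) → Set
Prod M = (n : ℕ) → Carrier (M n)

RPEq : (M : ℕ → Structure) → Pred Subset 0ℓ → Prod M → Prod M → Set
RPEq M I a b = I (λ n → a n ≢ b n)

RPLe : (M : ℕ → Structure) → Pred Subset 0ℓ → Prod M → Prod M → Set
RPLe M I a b = I (λ n → ¬ (_≤_ (M n) (a n) (b n)))

RPEqOn : (M : ℕ → Structure) → Pred Subset 0ℓ → Subset → Prod M → Prod M → Set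
RPEqOn M I S a b = I (λ n → S n × a n ≢ b n)

record IsRPIso (M N : ℕ → Structure) (I J : Pred Subset 0ℓ)
               (Φ : Prod M → Prod N) : Set where
  field
    wd         : ∀ {a b} → RPEq M I a b → RPEq N J (Φ a) (Φ b)
    injective  : ∀ {a b} → RPEq N J (Φ a) (Φ b) → RPEq M I a b
    surjective : ∀ (c : Prod N) → ∃[ a ] RPEq N J (Φ a) c
    pres-≤     : ∀ {a b} → RPLe M I a b → RPLe N J (Φ a) (Φ b)
    refl-≤     : ∀ {a b} → RPLe N J (Φ a) (Φ b) → RPLe M I a b

CoordinateRespecting : (M N : ℕ → Structure) (I J : Pred Subset 0ℓ)
                       (Φ : Prod M → Prod N) → Set₁
CoordinateRespecting M N I J Φ =
  ∃[ α ] (IsBoolIso I J α ×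
          (∀ (S : Subset) (a b : Prod M) →
             RPEqOn M I S a b → RPEqOn N J (α S) (Φ a) (Φ b)))

-- A theory T (given by its class of models, a predicate on structures)
-- recognizes coordinates.
RecognizesCoordinates : (Structure → Set) → Set₁
RecognizesCoordinates Model =
  ∀ (I J : Pred Subset 0ℓ) → IsIdeal I → IsIdeal J → Atomless I → Atomless J →
  ∀ (M N : ℕ → Structure) →
  (∀ n → Model (M n)) → (∀ n → AtLeastTwo (M n)) →
  (∀ n → Model (N n)) → (∀ n → AtLeastTwo (N n)) →
  ∀ (Φ : Prod M → Prod N) → IsRPIso M N I J Φ →
  CoordinateRespecting M N I J Φ

-- For a set S let glue S a b be the element that agrees with a on S and with b off S.
-- Each glue S satisfies a handful of equational and monotonicity laws (IsGluing), and these
-- laws are transported along any isomorphism Φ of reduced products.  Conversely, in a reduced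
-- product of connected ramified sets every operation γ with these laws is glue R for the set R
-- on which γ q p = q, where p ≼ q is a fixed pair that differs almost everywhere: coordinatewise,
-- γ a e for e below a is either a or e, and the choice cannot differ between two elements above
-- e, because two elements with a common upper bound are comparable; a common lower bound of a,
-- b and p reduces γ a b to this case.  Applied to the pullback of glue ⟦Φx ≡ Φy⟧, this shows
-- that Φ preserves (and, via Φ⁻¹, reflects) inclusions ⟦x ≡ y⟧ ⊆ ⟦u ≡ v⟧ modulo the ideals.
-- Hence S ↦ ⟦Φ (glue S q p) ≡ Φ q⟧ is a surjective order embedding of P(ℕ)/I into P(ℕ)/J,
-- i.e. a Boolean isomorphism, and Φ respects coordinates along it.

module Submission where

open import Defs
open import Level using (0ℓ)
open import Axiom.ExcludedMiddle using (ExcludedMiddle)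
open import Data.Nat using (ℕ)
open import Data.Product using (∃-syntax; _×_; _,_; proj₁; proj₂)
open import Data.Sum using (_⊎_; inj₁; inj₂; [_,_])
open import Data.Empty using (⊥-elim)
open import Function using (flip; _∘_; case_of_)
open import Relation.Nullary using (¬_; yes; no)
open import Relation.Binary.PropositionalEquality
  using (_≡_; _≢_; refl; sym; trans; subst; subst₂; module ≡-Reasoning)
open import Relation.Binary.Bundles using (Poset)
import Relation.Binary.Reasoning.PartialOrder
open import Relation.Unary using (Pred; _⊆_; _∪_; _∩_; ∁; ∅; U)

module Classical (lem : ExcludedMiddle 0ℓ) where

  Section : (ℕ → Set) → Set
  Section A = (n : ℕ) → A n

  ⟦_≡_⟧ : {A : ℕ → Set} → Section A → Section A → Subset
  ⟦ a ≡ b ⟧ n = a n ≡ b n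

  by-cases : {P : Set} (Q : Set) → (Q → P) → (¬ Q → P) → P
  by-cases Q if-yes if-no with lem {Q}
  ... | yes q = if-yes q
  ... | no ¬q = if-no ¬q

  -- Kept abstract so that goals show glue S a b n instead of a stuck case on lem; glue-elim is
  -- its only interface.
  abstract
    glue : {A : ℕ → Set} → Subset → Section A → Section A → Section A
    glue S a b n with lem {S n}
    ... | yes _ = a n
    ... | no  _ = b n

    glue-elim : {A : ℕ → Set} {S : Subset} {a b : Section A} {n : ℕ} (Q : A n → Set) →
                (S n → Q (a n)) → (¬ S n → Q (b n)) → Q (glue S a b n)
    glue-elim {S = S} {n = n} Q inside outside with lem {S n}
    ... | yes s = inside s
    ... | no ¬s = outside ¬s

  module _ {A : ℕ → Set} {S : Subset} {a b : Section A} {n : ℕ} where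

    glue-in : S n → glue S a b n ≡ a n
    glue-in s = glue-elim (λ x → x ≡ a n) (λ _ → refl) (λ ¬s → ⊥-elim (¬s s))

    glue-out : ¬ S n → glue S a b n ≡ b n
    glue-out ¬s = glue-elim (λ x → x ≡ b n) (λ s → ⊥-elim (¬s s)) (λ _ → refl)

    glue-when-≡ : a n ≡ b n → glue S a b n ≡ a n
    glue-when-≡ a≡b = glue-elim (λ x → x ≡ a n) (λ _ → refl) (λ _ → sym a≡b)

    glue≡ˡ⇒∈ : a n ≢ b n → glue S a b n ≡ a n → S n
    glue≡ˡ⇒∈ a≢b = glue-elim (λ x → x ≡ a n → S n) (λ s _ → s) (λ _ b≡a → ⊥-elim (a≢b (sym b≡a)))

  module _ {A : ℕ → Set} {S : Subset} {n : ℕ} where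

    glue-idem : (a : Section A) → glue S a a n ≡ a n
    glue-idem a = glue-elim (λ x → x ≡ a n) (λ _ → refl) (λ _ → refl)

    glue-absorbˡ : (a b c : Section A) → glue S (glue S a b) c n ≡ glue S a c n
    glue-absorbˡ a b c = by-cases (S n)
      (λ s → trans (glue-in s) (trans (glue-in s) (sym (glue-in s))))
      (λ ¬s → trans (glue-out ¬s) (sym (glue-out ¬s)))

    glue-absorbʳ : (a b c : Section A) → glue S a (glue S b c) n ≡ glue S a c n
    glue-absorbʳ a b c = by-cases (S n)
      (λ s → trans (glue-in s) (sym (glue-in s)))
      (λ ¬s → trans (glue-out ¬s) (trans (glue-out ¬s) (sym (glue-out ¬s))))

    glue-∁ : (a b : Section A) → glue (∁ S) a b n ≡ glue S b a n
    glue-∁ a b = by-cases (S n)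
      (λ s → trans (glue-out (λ ¬s → ¬s s)) (sym (glue-in s)))
      (λ ¬s → trans (glue-in ¬s) (sym (glue-out ¬s)))

  module AlmostEverywhere (I : Pred Subset 0ℓ) (isI : IsIdeal I) where
    open IsIdeal isI

    AE : Subset → Set
    AE P = I (∁ P)

    ae-always : ∀ {P} → (∀ n → P n) → AE P
    ae-always p = downward (λ {n} ¬p → ¬p (p n)) has-∅

    ae-map : ∀ {P Q} → (∀ n → P n → Q n) → AE P → AE Q
    ae-map f = downward (λ {n} ¬q p → ¬q (f n p))

    ae-zip : ∀ {P Q} → AE P → AE Q → AE (P ∩ Q)
    ae-zip {P} ae-P ae-Q = downward ¬∩⇒¬∪¬ (unions ae-P ae-Q)
      where
      ¬∩⇒¬∪¬ : ∀ {n} → ¬ (P n × _) → _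
      ¬∩⇒¬∪¬ {n} ¬pq = by-cases (P n) (λ p → inj₂ (λ q → ¬pq (p , q))) inj₁

    ae-map₂ : ∀ {P Q R} → (∀ n → P n → Q n → R n) → AE P → AE Q → AE R
    ae-map₂ f ae-P ae-Q = ae-map (λ n (p , q) → f n p q) (ae-zip ae-P ae-Q)

    ae-map₃ : ∀ {P Q R T} → (∀ n → P n → Q n → R n → T n) → AE P → AE Q → AE R → AE T
    ae-map₃ f ae-P ae-Q ae-R = ae-map₂ (λ n (p , q) → f n p q) (ae-zip ae-P ae-Q) ae-R

    infix 4 _⊆ᵃ_ _≈ᵃ_

    _⊆ᵃ_ : Subset → Subset → Set
    S ⊆ᵃ T = AE (λ n → S n → T n)

    ⊆⇒⊆ᵃ : ∀ {S T} → S ⊆ T → S ⊆ᵃ T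
    ⊆⇒⊆ᵃ S⊆T = ae-always (λ n → S⊆T)

    ⊆ᵃ-trans : ∀ {S T V} → S ⊆ᵃ T → T ⊆ᵃ V → S ⊆ᵃ V
    ⊆ᵃ-trans = ae-map₂ (λ n f g s → g (f s))

    ⊆ᵃ⇒⊑ : ∀ {S T} → S ⊆ᵃ T → S ⊑[ I ] T
    ⊆ᵃ⇒⊑ = downward (λ (s , ¬t) f → ¬t (f s))

    ⊑⇒⊆ᵃ : ∀ {S T} → S ⊑[ I ] T → S ⊆ᵃ T
    ⊑⇒⊆ᵃ {S} = downward ¬⇒⇒∖
      where
      ¬⇒⇒∖ : ∀ {n} → ¬ (S n → _) → _
      ¬⇒⇒∖ {n} ¬f = by-cases (S n) (λ s → s , (λ t → ¬f (λ _ → t))) (λ ¬s → ⊥-elim (¬f (⊥-elim ∘ ¬s)))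

    _≈ᵃ_ : {A : ℕ → Set} → Section A → Section A → Set
    a ≈ᵃ b = AE ⟦ a ≡ b ⟧

    module _ {A : ℕ → Set} where

      ≈ᵃ-refl : (a : Section A) → a ≈ᵃ a
      ≈ᵃ-refl a = ae-always (λ n → refl)

      ≈ᵃ-sym : {a b : Section A} → a ≈ᵃ b → b ≈ᵃ a
      ≈ᵃ-sym = ae-map (λ n → sym)

      ≈ᵃ-trans : {a b c : Section A} → a ≈ᵃ b → b ≈ᵃ c → a ≈ᵃ c
      ≈ᵃ-trans = ae-map₂ (λ n → trans)

      ⟦≡⟧-resp-≈ᵃ : {a a′ b b′ : Section A} → a ≈ᵃ a′ → b ≈ᵃ b′ → ⟦ a ≡ b ⟧ ⊆ᵃ ⟦ a′ ≡ b′ ⟧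
      ⟦≡⟧-resp-≈ᵃ = ae-map₂ (λ n a≡a′ b≡b′ a≡b → trans (sym a≡a′) (trans a≡b b≡b′))

      glue-cong : {S : Subset} {a a′ b b′ : Section A} →
                  a ≈ᵃ a′ → b ≈ᵃ b′ → glue S a b ≈ᵃ glue S a′ b′
      glue-cong {S} {a} {a′} {b} {b′} = ae-map₂ agree
        where
        agree : ∀ n → a n ≡ a′ n → b n ≡ b′ n → glue S a b n ≡ glue S a′ b′ n
        agree n a≡a′ b≡b′ = by-cases (S n)
          (λ s → trans (glue-in s) (trans a≡a′ (sym (glue-in s))))
          (λ ¬s → trans (glue-out ¬s) (trans b≡b′ (sym (glue-out ¬s))))

      glue-resp-⇔ : {S T : Subset} {a b : Section A} →
                     AE (λ n → a n ≢ b n → (S n → T n) × (T n → S n)) →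
                     glue S a b ≈ᵃ glue T a b
      glue-resp-⇔ {S} {T} {a} {b} = ae-map agree
        where
        agree : ∀ n → (a n ≢ b n → (S n → T n) × (T n → S n)) → glue S a b n ≡ glue T a b n
        agree n S⇔T = by-cases (a n ≡ b n)
          (λ a≡b → trans (glue-when-≡ a≡b) (sym (glue-when-≡ a≡b)))
          (λ a≢b → by-cases (S n)
            (λ s → trans (glue-in s) (sym (glue-in (proj₁ (S⇔T a≢b) s))))
            (λ ¬s → trans (glue-out ¬s) (sym (glue-out (λ t → ¬s (proj₂ (S⇔T a≢b) t))))))

      glue≈ʳ⇒⊆ᵃ : {S : Subset} {a b : Section A} → glue S a b ≈ᵃ b → S ⊆ᵃ ⟦ a ≡ b ⟧
      glue≈ʳ⇒⊆ᵃ = ae-map (λ n g≡b s → trans (sym (glue-in s)) g≡b)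

      ⟦glue≡ˡ⟧⊆ᵃ : {S : Subset} {a b : Section A} → AE (λ n → a n ≢ b n) → ⟦ glue S a b ≡ a ⟧ ⊆ᵃ S
      ⟦glue≡ˡ⟧⊆ᵃ = ae-map (λ n → glue≡ˡ⇒∈)

      ⊆ᵃ⇒glue≈ʳ : {S : Subset} {a b : Section A} → S ⊆ᵃ ⟦ a ≡ b ⟧ → glue S a b ≈ᵃ b
      ⊆ᵃ⇒glue≈ʳ {S} {a} {b} = ae-map (λ n a≡b-on-S →
        glue-elim (λ x → x ≡ b n) a≡b-on-S (λ _ → refl))

  module ReducedProduct (I : Pred Subset 0ℓ) (isI : IsIdeal I)
                        (M : ℕ → Structure) (ramified-sets : ∀ n → IsConnectedRamifiedSet (M n)) where
    open AlmostEverywhere I isI public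

    module Tree (n : ℕ) = IsConnectedRamifiedSet (ramified-sets n)

    C : ℕ → Set
    C n = Carrier (M n)

    Le : (n : ℕ) → C n → C n → Set
    Le n = _≤_ (M n)
    syntax Le n x y = x ≤[ n ] y

    Comparable : (n : ℕ) → C n → C n → Set
    Comparable n x y = x ≤[ n ] y ⊎ y ≤[ n ] x

    infix 4 _≈_ _≼_

    _≈_ : Prod M → Prod M → Set
    _≈_ = RPEq M I

    _≼_ : Prod M → Prod M → Set
    _≼_ = RPLe M I

    ≼-refl : ∀ {a} → a ≼ a
    ≼-refl {a} = ae-always (λ n → Tree.refl′ n (a n))

    ≈⇒≼ : ∀ {a b} → a ≈ b → a ≼ b
    ≈⇒≼ {a} = ae-map (λ n a≡b → subst (λ x → a n ≤[ n ] x) a≡b (Tree.refl′ n (a n)))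

    ≼-trans : ∀ {a b c} → a ≼ b → b ≼ c → a ≼ c
    ≼-trans = ae-map₂ (λ n → Tree.trans′ n)

    ≼-antisym : ∀ {a b} → a ≼ b → b ≼ a → a ≈ b
    ≼-antisym = ae-map₂ (λ n → Tree.antisym′ n)

    ≼-poset : Poset 0ℓ 0ℓ 0ℓ
    ≼-poset = record
      { _≈_ = _≈_
      ; _≤_ = _≼_
      ; isPartialOrder = record
        { isPreorder = record
          { isEquivalence = record { refl = ≈ᵃ-refl _ ; sym = ≈ᵃ-sym ; trans = ≈ᵃ-trans }
          ; reflexive = ≈⇒≼
          ; trans = ≼-trans
          }
        ; antisym = ≼-antisym
        }
      }

    module ≼-Reasoning = Relation.Binary.Reasoning.PartialOrder ≼-poset

    ≼glue : ∀ {S c a b} → c ≼ a → c ≼ b → c ≼ glue S a b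
    ≼glue {c = c} = ae-map₂ (λ n c≤a c≤b → glue-elim {C} (λ x → c n ≤[ n ] x) (λ _ → c≤a) (λ _ → c≤b))

    glue≼ : ∀ {S a b d} → a ≼ d → b ≼ d → glue S a b ≼ d
    glue≼ {d = d} = ae-map₂ (λ n a≤d b≤d → glue-elim {C} (λ x → x ≤[ n ] d n) (λ _ → a≤d) (λ _ → b≤d))

    common-bound⇒Comparable : ∀ n {x y d} → x ≤[ n ] d → y ≤[ n ] d → Comparable n x y
    common-bound⇒Comparable n = Tree.ramified n

    Comparable⇒≰⇒≥ : ∀ n {x y} → Comparable n x y → ¬ x ≤[ n ] y → y ≤[ n ] x
    Comparable⇒≰⇒≥ n (inj₁ x≤y) x≰y = ⊥-elim (x≰y x≤y)
    Comparable⇒≰⇒≥ n (inj₂ y≤x) _   = y≤x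

    below : Prod M → Prod M → Prod M
    below a b n = proj₁ (Tree.connected n (a n) (b n))

    below≼ˡ : ∀ {a b} → below a b ≼ a
    below≼ˡ {a} {b} = ae-always (λ n → proj₁ (proj₂ (Tree.connected n (a n) (b n))))

    below≼ʳ : ∀ {a b} → below a b ≼ b
    below≼ʳ {a} {b} = ae-always (λ n → proj₂ (proj₂ (Tree.connected n (a n) (b n))))

    lower upper : Prod M → Prod M → Prod M
    lower a b = glue (λ n → a n ≤[ n ] b n) a b
    upper a b = glue (λ n → a n ≤[ n ] b n) b a

    lower-upper-cases : ∀ a b n → (lower a b n ≡ a n × upper a b n ≡ b n)
                                ⊎ (lower a b n ≡ b n × upper a b n ≡ a n)
    lower-upper-cases a b n = by-cases (a n ≤[ n ] b n)
      (λ a≤b → inj₁ (glue-in a≤b , glue-in a≤b))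
      (λ a≰b → inj₂ (glue-out a≰b , glue-out a≰b))

    lower≼ʳ : ∀ {a b} → lower a b ≼ b
    lower≼ʳ {a} {b} = ae-always (λ n →
      glue-elim {C} (λ x → x ≤[ n ] b n) (λ a≤b → a≤b) (λ _ → Tree.refl′ n (b n)))

    ≼upperˡ : ∀ {a b} → a ≼ upper a b
    ≼upperˡ {a} {b} = ae-always (λ n →
      glue-elim {C} (λ x → a n ≤[ n ] x) (λ a≤b → a≤b) (λ _ → Tree.refl′ n (a n)))

    ≤upperʳ : ∀ {a b} n → Comparable n (a n) (b n) → b n ≤[ n ] upper a b n
    ≤upperʳ {a} {b} n a∼b =
      glue-elim {C} (λ x → b n ≤[ n ] x) (λ _ → Tree.refl′ n (b n)) (Comparable⇒≰⇒≥ n a∼b)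

    ≤lowerˡ : ∀ {a b} n → Comparable n (a n) (b n) → lower a b n ≤[ n ] a n
    ≤lowerˡ {a} {b} n a∼b =
      glue-elim {C} (λ x → x ≤[ n ] a n) (λ _ → Tree.refl′ n (a n)) (Comparable⇒≰⇒≥ n a∼b)

    lower≼ˡ : ∀ {a b d} → a ≼ d → b ≼ d → lower a b ≼ a
    lower≼ˡ = ae-map₂ (λ n a≤d b≤d → ≤lowerˡ n (common-bound⇒Comparable n a≤d b≤d))

    ≼upperʳ : ∀ {a b d} → a ≼ d → b ≼ d → b ≼ upper a b
    ≼upperʳ = ae-map₂ (λ n a≤d b≤d → ≤upperʳ n (common-bound⇒Comparable n a≤d b≤d))

    -- The laws of glue S that are invariant under isomorphism; IsGluing⇒≈glue shows that they
    -- characterize the gluings.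
    record IsGluing (γ : Prod M → Prod M → Prod M) : Set where
      field
        cong    : ∀ {a a′ b b′} → a ≈ a′ → b ≈ b′ → γ a b ≈ γ a′ b′
        idem    : ∀ a → γ a a ≈ a
        absorbˡ : ∀ a b c → γ (γ a b) c ≈ γ a c
        absorbʳ : ∀ a b c → γ a (γ b c) ≈ γ a c
        mono    : ∀ {a a′ b b′} → a ≼ a′ → b ≼ b′ → γ a b ≼ γ a′ b′

    IsGluing-flip : ∀ {γ} → IsGluing γ → IsGluing (flip γ)
    IsGluing-flip G = record
      { cong    = λ a≈a′ b≈b′ → cong b≈b′ a≈a′
      ; idem    = idem
      ; absorbˡ = λ a b c → absorbʳ c b a
      ; absorbʳ = λ a b c → absorbˡ c b a
      ; mono    = λ a≼a′ b≼b′ → mono b≼b′ a≼a′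
      }
      where open IsGluing G

    glue-isGluing : ∀ S → IsGluing (glue S)
    glue-isGluing S = record
      { cong    = glue-cong
      ; idem    = λ a → ae-always (λ n → glue-idem a)
      ; absorbˡ = λ a b c → ae-always (λ n → glue-absorbˡ a b c)
      ; absorbʳ = λ a b c → ae-always (λ n → glue-absorbʳ a b c)
      ; mono    = ae-map₂ glue-mono
      }
      where
      glue-mono : ∀ {a a′ b b′} n → a n ≤[ n ] a′ n → b n ≤[ n ] b′ n →
                  glue S a b n ≤[ n ] glue S a′ b′ n
      glue-mono n a≤a′ b≤b′ = by-cases (S n)
        (λ s → subst₂ (Le n) (sym (glue-in s)) (sym (glue-in s)) a≤a′)
        (λ ¬s → subst₂ (Le n) (sym (glue-out ¬s)) (sym (glue-out ¬s)) b≤b′)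

    module Interval {γ} (G : IsGluing γ) where
      open IsGluing G
      open ≼-Reasoning

      Split Split′ : Prod M → Prod M → Subset
      Split  c d n = γ d c n ≡ d n
      Split′ c d n = γ c d n ≡ d n

      ≼γ : ∀ {c a b} → c ≼ a → c ≼ b → c ≼ γ a b
      ≼γ {c} {a} {b} c≼a c≼b = begin
        c      ≈⟨ idem c ⟨
        γ c c  ≤⟨ mono c≼a c≼b ⟩
        γ a b  ∎

      γ≼ : ∀ {a b d} → a ≼ d → b ≼ d → γ a b ≼ d
      γ≼ {a} {b} {d} a≼d b≼d = begin
        γ a b  ≤⟨ mono a≼d b≼d ⟩
        γ d d  ≈⟨ idem d ⟩
        d      ∎

      dichotomy : ∀ {c d} → c ≼ d →
                  AE (λ n → (γ d c n ≡ c n × γ c d n ≡ d n) ⊎ (γ d c n ≡ d n × γ c d n ≡ c n))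
      dichotomy {c} {d} c≼d = ae-map₂ sorted (≼-antisym lower≼c c≼lower) (≼-antisym upper≼d d≼upper)
        where
        g h : Prod M
        g = γ d c
        h = γ c d
        c≼g : c ≼ g
        c≼g = ≼γ c≼d ≼-refl
        c≼h : c ≼ h
        c≼h = ≼γ ≼-refl c≼d
        g≼d : g ≼ d
        g≼d = γ≼ ≼-refl c≼d
        h≼d : h ≼ d
        h≼d = γ≼ c≼d ≼-refl
        lower≼c : lower g h ≼ c
        lower≼c = begin
          lower g h                    ≈⟨ idem (lower g h) ⟨
          γ (lower g h) (lower g h)    ≤⟨ mono lower≼ʳ (lower≼ˡ g≼d h≼d) ⟩
          γ (γ c d) (γ d c)            ≈⟨ absorbˡ c d g ⟩
          γ c (γ d c)                  ≈⟨ absorbʳ c d c ⟩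
          γ c c                        ≈⟨ idem c ⟩
          c                            ∎
        d≼upper : d ≼ upper g h
        d≼upper = begin
          d                            ≈⟨ idem d ⟨
          γ d d                        ≈⟨ absorbʳ d c d ⟨
          γ d (γ c d)                  ≈⟨ absorbˡ d c h ⟨
          γ (γ d c) (γ c d)            ≤⟨ mono ≼upperˡ (≼upperʳ g≼d h≼d) ⟩
          γ (upper g h) (upper g h)    ≈⟨ idem (upper g h) ⟩
          upper g h                    ∎
        c≼lower : c ≼ lower g h
        c≼lower = ≼glue c≼g c≼h
        upper≼d : upper g h ≼ d
        upper≼d = glue≼ h≼d g≼d
        sorted : ∀ n → lower g h n ≡ c n → upper g h n ≡ d n →
                 (g n ≡ c n × h n ≡ d n) ⊎ (g n ≡ d n × h n ≡ c n)
        sorted n lower≡c upper≡d with lower-upper-cases g h n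
        ... | inj₁ (lower≡g , upper≡h) = inj₁ (trans (sym lower≡g) lower≡c , trans (sym upper≡h) upper≡d)
        ... | inj₂ (lower≡h , upper≡g) = inj₂ (trans (sym upper≡g) upper≡d , trans (sym lower≡h) lower≡c)

      Split⊎Split′ : ∀ {c d} → c ≼ d → AE (λ n → Split c d n ⊎ Split′ c d n)
      Split⊎Split′ = ae-map (λ n → λ { (inj₁ (_ , γcd≡d)) → inj₂ γcd≡d ; (inj₂ (γdc≡d , _)) → inj₁ γdc≡d })
                   ∘ dichotomy

      interval : ∀ {c z d} → c ≼ z → z ≼ d → γ z c ≈ glue (Split c d) z c
      interval {c} {z} {d} c≼z z≼d = ≼-antisym γzc≼k k≼γzc
        where
        c≼d : c ≼ d
        c≼d = ≼-trans c≼z z≼d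
        g k : Prod M
        g = γ d c
        k = glue (Split c d) z c
        γzc≼k : γ z c ≼ k
        γzc≼k = ae-map₃ bounded (γ≼ ≼-refl c≼z) (mono z≼d ≼-refl) (dichotomy c≼d)
          where
          bounded : ∀ n → γ z c n ≤[ n ] z n → γ z c n ≤[ n ] g n →
                  (g n ≡ c n × _) ⊎ (g n ≡ d n × _) → γ z c n ≤[ n ] k n
          bounded n γ≤z γ≤g g∈cd = glue-elim {C} (λ x → γ z c n ≤[ n ] x) (λ _ → γ≤z) λ ¬split →
            case g∈cd of λ { (inj₁ (g≡c , _)) → subst (λ x → γ z c n ≤[ n ] x) g≡c γ≤g
                              ; (inj₂ (g≡d , _)) → ⊥-elim (¬split g≡d) }
        k≼g : k ≼ g
        k≼g = ae-map₂ (λ n z≤d c≤g → glue-elim {C} (λ x → x ≤[ n ] g n)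
                        (λ g≡d → subst (λ x → z n ≤[ n ] x) (sym g≡d) z≤d) (λ _ → c≤g))
                      z≼d (≼γ c≼d ≼-refl)
        γgk≈g : γ g k ≈ g
        γgk≈g = ≼-antisym (γ≼ ≼-refl k≼g) (begin
          g        ≈⟨ absorbˡ d c c ⟨
          γ g c    ≤⟨ mono ≼-refl (≼glue c≼z ≼-refl) ⟩
          γ g k    ∎)
        k≼γzc : k ≼ γ z c
        k≼γzc = begin
          k              ≈⟨ idem k ⟨
          γ k k          ≈⟨ absorbʳ k g k ⟨
          γ k (γ g k)    ≈⟨ cong (≈ᵃ-refl k) γgk≈g ⟩
          γ k g          ≈⟨ absorbʳ k d c ⟩
          γ k c          ≤⟨ mono (glue≼ ≼-refl c≼z) ≼-refl ⟩
          γ z c          ∎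

      Split-interval : ∀ {c z d} → c ≼ z → z ≼ d →
                       AE (λ n → z n ≢ c n → (Split c z n → Split c d n) × (Split c d n → Split c z n))
      Split-interval c≼z z≼d = ae-map
        (λ n γ≡k z≢c → (λ γ≡z → glue≡ˡ⇒∈ z≢c (trans (sym γ≡k) γ≡z)) , (λ split → trans γ≡k (glue-in split)))
        (interval c≼z z≼d)

      Split⇒γ≡lower : ∀ {c d} → c ≼ d → AE (λ n → c n ≢ d n) → Split c d ⊆ᵃ ⟦ γ c d ≡ c ⟧
      Split⇒γ≡lower c≼d c≢d = ae-map₂ pick (dichotomy c≼d) c≢d
        where
        pick : ∀ n → _ → _ → Split _ _ n → _
        pick n (inj₁ (γdc≡c , _)) c≢d γdc≡d = ⊥-elim (c≢d (trans (sym γdc≡c) γdc≡d))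
        pick n (inj₂ (_ , γcd≡c)) _   _     = γcd≡c

      Split′⇔∁Split : ∀ {c d} → c ≼ d → AE (λ n → c n ≢ d n) →
                      AE (λ n → (Split′ c d n → ¬ Split c d n) × (¬ Split c d n → Split′ c d n))
      Split′⇔∁Split c≼d c≢d = ae-map₃
        (λ n dich split⊎split′ c≢d →
          exclusive n dich c≢d , λ ¬split → [ ⊥-elim ∘ ¬split , (λ split′ → split′) ] split⊎split′)
        (dichotomy c≼d) (Split⊎Split′ c≼d) c≢d
        where
        exclusive : ∀ n → _ → _ → Split′ _ _ n → ¬ Split _ _ n
        exclusive n (inj₁ (γdc≡c , _)) c≢d _ γdc≡d = c≢d (trans (sym γdc≡c) γdc≡d)
        exclusive n (inj₂ (_ , γcd≡c)) c≢d γcd≡d _ = c≢d (trans (sym γcd≡c) γcd≡d)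

      glue-Split′ : ∀ {c d} → c ≼ d → AE (λ n → c n ≢ d n) →
                    ∀ a b → glue (Split′ c d) a b ≈ glue (Split c d) b a
      glue-Split′ c≼d c≢d a b =
        ≈ᵃ-trans (glue-resp-⇔ (ae-map (λ n split′⇔∁split _ → split′⇔∁split) (Split′⇔∁Split c≼d c≢d)))
                 (ae-always (λ n → glue-∁ a b))

    module Splitting {γ} (G : IsGluing γ) where
      open IsGluing G
      open Interval G
      private module Flipped = Interval (IsGluing-flip G)

      Split-baseˡ : ∀ {e p q} → e ≼ p → p ≼ q → Split e q ⊆ᵃ Split p q
      Split-baseˡ {e} {p} {q} e≼p p≼q = ae-map₂ top (absorbˡ q p e) (interval e≼g g≼q)
        where
        g : Prod M
        g = γ q p
        e≼g : e ≼ g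
        e≼g = ≼-trans e≼p (≼γ p≼q ≼-refl)
        g≼q : g ≼ q
        g≼q = γ≼ ≼-refl p≼q
        top : ∀ n → γ g e n ≡ γ q e n → γ g e n ≡ glue (Split e q) g e n → Split e q n → g n ≡ q n
        top n γge≡γqe γge≡k γqe≡q = begin
          g n                       ≡⟨ glue-in γqe≡q ⟨
          glue (Split e q) g e n    ≡⟨ γge≡k ⟨
          γ g e n                   ≡⟨ γge≡γqe ⟩
          γ q e n                   ≡⟨ γqe≡q ⟩
          q n                       ∎
          where open ≡-Reasoning

      Split-baseʳ : ∀ {e p q} → e ≼ p → p ≼ q → AE (λ n → p n ≢ q n) → Split p q ⊆ᵃ Split e q
      Split-baseʳ {e} {p} {q} e≼p p≼q p≢q = ⊆ᵃ-trans (Split⇒γ≡lower p≼q p≢q) h≡p⇒Split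
        where
        h : Prod M
        h = γ p q
        e≼h : e ≼ h
        e≼h = ≼-trans e≼p (≼γ ≼-refl p≼q)
        h≼q : h ≼ q
        h≼q = γ≼ p≼q ≼-refl
        Split′⇒γ≡h : Split′ e q ⊆ᵃ ⟦ γ e q ≡ h ⟧
        Split′⇒γ≡h = ae-map₂ (λ n γeh≡γeq γeh≡k split′ → trans (sym γeh≡γeq) (trans γeh≡k (glue-in split′)))
                             (absorbʳ e p q) (Flipped.interval e≼h h≼q)
        h≡p⇒Split : ⟦ h ≡ p ⟧ ⊆ᵃ Split e q
        h≡p⇒Split = ae-map₃ forced (Split⊎Split′ (≼-trans e≼p p≼q)) Split′⇒γ≡h p≢q
          where
          forced : ∀ n → Split e q n ⊎ Split′ e q n → (Split′ e q n → γ e q n ≡ h n) → p n ≢ q n →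
                   h n ≡ p n → Split e q n
          forced n (inj₁ split)  _   _   _   = split
          forced n (inj₂ γeq≡q) γ≡h p≢q h≡p = ⊥-elim (p≢q (trans (sym h≡p) (trans (sym (γ≡h γeq≡q)) γeq≡q)))

      Split-incomparable : ∀ {e a b} → e ≼ a → e ≼ b →
                           AE (λ n → ¬ Comparable n (a n) (b n) → Split e a n → Split e b n)
      Split-incomparable {e} {a} {b} e≼a e≼b =
        ae-map₃ forced (Split⊎Split′ e≼b) (mono ≼-refl e≼b) (mono e≼a ≼-refl)
        where
        forced : ∀ n → Split e b n ⊎ Split′ e b n → γ a e n ≤[ n ] γ a b n → γ e b n ≤[ n ] γ a b n →
                 ¬ Comparable n (a n) (b n) → Split e a n → Split e b n
        forced n (inj₁ split) _ _ _ _ = split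
        forced n (inj₂ γeb≡b) γae≤γab γeb≤γab a≁b γae≡a = ⊥-elim (a≁b (common-bound⇒Comparable n
          (subst (λ x → x ≤[ n ] γ a b n) γae≡a γae≤γab) (subst (λ x → x ≤[ n ] γ a b n) γeb≡b γeb≤γab)))

      Split-comparable : ∀ {e a b} → e ≼ a → e ≼ b →
                         AE (λ n → Comparable n (a n) (b n) → a n ≢ e n → b n ≢ e n →
                                   Split e a n → Split e b n)
      Split-comparable {e} {a} {b} e≼a e≼b =
        ae-map₃ chain (Split-interval e≼a′ a′≼a) (Split-interval e≼a′ a′≼d) (Split-interval e≼b b≼d)
        where
        -- a′ and d agree with a and with the larger of a, b where these are comparable and are
        -- replaced by e and b elsewhere, so that e ≼ a′ ≼ d and e ≼ b ≼ d hold everywhere.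
        Cmp : Subset
        Cmp n = Comparable n (a n) (b n)
        a′ d : Prod M
        a′ = glue Cmp a e
        d  = glue Cmp (upper a b) b
        e≼a′ : e ≼ a′
        e≼a′ = ≼glue e≼a ≼-refl
        a′≼a : a′ ≼ a
        a′≼a = glue≼ ≼-refl e≼a
        a′≼d : a′ ≼ d
        a′≼d = IsGluing.mono (glue-isGluing Cmp) ≼upperˡ e≼b
        b≼d : b ≼ d
        b≼d = ae-always (λ n → glue-elim {C} (λ x → b n ≤[ n ] x) (≤upperʳ n) (λ _ → Tree.refl′ n (b n)))
        chain : ∀ n → _ → _ → _ → Cmp n → a n ≢ e n → b n ≢ e n → Split e a n → Split e b n
        chain n a′∼a a′∼d b∼d cmp a≢e b≢e =
          proj₂ (b∼d b≢e) ∘ proj₁ (a′∼d a′≢e) ∘ proj₂ (a′∼a a′≢e)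
          where
          a′≢e : a′ n ≢ e n
          a′≢e = subst (λ x → x ≢ e n) (sym (glue-in cmp)) a≢e

      Split-agree : ∀ {e a b} → e ≼ a → e ≼ b →
                    AE (λ n → a n ≢ e n → b n ≢ e n → Split e a n → Split e b n)
      Split-agree {a = a} {b} e≼a e≼b = ae-map₂
        (λ n comparable incomparable a≢e b≢e → by-cases (Comparable n (a n) (b n))
          (λ a∼b → comparable a∼b a≢e b≢e) incomparable)
        (Split-comparable e≼a e≼b) (Split-incomparable e≼a e≼b)

      module _ {p q} (p≼q : p ≼ q) (p≢q : AE (λ n → p n ≢ q n)) where

        γ≈glue-below : ∀ {e a} → e ≼ p → e ≼ a → γ a e ≈ glue (Split p q) a e
        γ≈glue-below {e} {a} e≼p e≼a =
          ≈ᵃ-trans (interval e≼a ≼-refl)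
                   (glue-resp-⇔ (ae-map₂ (λ n to from a≢e → to a≢e , from a≢e) to from))
          where
          e≼q : e ≼ q
          e≼q = ≼-trans e≼p p≼q
          q≢e : AE (λ n → q n ≢ e n)
          q≢e = ae-map₃ (λ n e≤p p≤q p≢q q≡e →
                          p≢q (Tree.antisym′ n p≤q (subst (λ x → x ≤[ n ] p n) (sym q≡e) e≤p)))
                        e≼p p≼q p≢q
          to : AE (λ n → a n ≢ e n → Split e a n → Split p q n)
          to = ae-map₃ (λ n agree base q≢e a≢e → base ∘ agree a≢e q≢e)
                       (Split-agree e≼a e≼q) (Split-baseˡ e≼p p≼q) q≢e
          from : AE (λ n → a n ≢ e n → Split p q n → Split e a n)
          from = ae-map₃ (λ n agree base q≢e a≢e → agree q≢e a≢e ∘ base)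
                         (Split-agree e≼q e≼a) (Split-baseʳ e≼p p≼q p≢q) q≢e

    IsGluing⇒≈glue : ∀ {γ} (G : IsGluing γ) {p q} → p ≼ q → AE (λ n → p n ≢ q n) →
                     ∀ a b → γ a b ≈ glue (Interval.Split G p q) a b
    IsGluing⇒≈glue {γ} G {p} {q} p≼q p≢q a b = begin-equality
      γ a b                ≈⟨ absorbʳ a e b ⟨
      γ a (γ e b)          ≈⟨ absorbˡ a e (γ e b) ⟨
      γ (γ a e) (γ e b)    ≈⟨ cong γae≈γke γeb≈γek ⟩
      γ (γ k e) (γ e k)    ≈⟨ absorbˡ k e (γ e k) ⟩
      γ k (γ e k)          ≈⟨ absorbʳ k e k ⟩
      γ k k                ≈⟨ idem k ⟩
      k                    ∎
      where
      open IsGluing G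
      open Interval G using (Split; glue-Split′)
      open ≼-Reasoning
      R : Subset
      R = Split p q
      e k : Prod M
      e = below (below a b) p
      k = glue R a b
      e≼a : e ≼ a
      e≼a = ≼-trans below≼ˡ below≼ˡ
      e≼b : e ≼ b
      e≼b = ≼-trans below≼ˡ below≼ʳ
      e≼k : e ≼ k
      e≼k = ≼glue e≼a e≼b
      γ·e≈glue : ∀ {c} → e ≼ c → γ c e ≈ glue R c e
      γ·e≈glue = Splitting.γ≈glue-below G p≼q p≢q below≼ʳ
      γe·≈glue : ∀ {c} → e ≼ c → γ e c ≈ glue R e c
      γe·≈glue {c} e≼c = ≈ᵃ-trans (Splitting.γ≈glue-below (IsGluing-flip G) p≼q p≢q below≼ʳ e≼c)
                                  (glue-Split′ p≼q p≢q c e)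
      γae≈γke : γ a e ≈ γ k e
      γae≈γke = ≈ᵃ-trans (γ·e≈glue e≼a)
                (≈ᵃ-trans (ae-always (λ n → sym (glue-absorbˡ a b e))) (≈ᵃ-sym (γ·e≈glue e≼k)))
      γeb≈γek : γ e b ≈ γ e k
      γeb≈γek = ≈ᵃ-trans (γe·≈glue e≼b)
                (≈ᵃ-trans (ae-always (λ n → sym (glue-absorbʳ e a b))) (≈ᵃ-sym (γe·≈glue e≼k)))

    strictly-comparable-pair : (∀ n → AtLeastTwo (M n)) → ∃[ p ] ∃[ q ] (p ≼ q × AE (λ n → p n ≢ q n))
    strictly-comparable-pair two =
      (λ n → proj₁ (pair n)) , (λ n → proj₁ (proj₂ (pair n))) ,
      ae-always (λ n → proj₁ (proj₂ (proj₂ (pair n)))) , ae-always (λ n → proj₂ (proj₂ (proj₂ (pair n))))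
      where
      pair : ∀ n → ∃[ x ] ∃[ y ] (x ≤[ n ] y × x ≢ y)
      pair n with two n
      ... | x , y , x≢y with Tree.connected n x y
      ...   | z , z≤x , z≤y = by-cases (z ≡ x)
                                (λ z≡x → z , y , z≤y , (λ z≡y → x≢y (trans (sym z≡x) z≡y)))
                                (λ z≢x → z , x , z≤x , z≢x)

  module Isomorphism (I J : Pred Subset 0ℓ) (isI : IsIdeal I) (isJ : IsIdeal J)
                     (M N : ℕ → Structure)
                     (ramified-M : ∀ n → IsConnectedRamifiedSet (M n))
                     (ramified-N : ∀ n → IsConnectedRamifiedSet (N n))
                     (Φ : Prod M → Prod N) (iso : IsRPIso M N I J Φ) where
    module Dom = ReducedProduct I isI M ramified-M
    module Cod = ReducedProduct J isJ N ramified-N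
    open Dom using (_≈_; _≼_; _⊆ᵃ_)
    open Cod using () renaming (_≈_ to _≈′_; _≼_ to _≼′_; _⊆ᵃ_ to _⊆ᵃ′_)
    open IsRPIso iso
    open Cod.≼-Reasoning

    Ψ : Prod N → Prod M
    Ψ c = proj₁ (surjective c)

    ΦΨ : ∀ c → Φ (Ψ c) ≈′ c
    ΦΨ c = proj₂ (surjective c)

    ΨΦ : ∀ a → Ψ (Φ a) ≈ a
    ΨΦ a = injective (ΦΨ (Φ a))

    Ψ-wd : ∀ {c c′} → c ≈′ c′ → Ψ c ≈ Ψ c′
    Ψ-wd {c} {c′} c≈c′ = injective (begin-equality
      Φ (Ψ c)   ≈⟨ ΦΨ c ⟩
      c         ≈⟨ c≈c′ ⟩
      c′        ≈⟨ ΦΨ c′ ⟨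
      Φ (Ψ c′)  ∎)

    Ψ-mono : ∀ {c c′} → c ≼′ c′ → Ψ c ≼ Ψ c′
    Ψ-mono {c} {c′} c≼c′ = refl-≤ (begin
      Φ (Ψ c)   ≈⟨ ΦΨ c ⟩
      c         ≤⟨ c≼c′ ⟩
      c′        ≈⟨ ΦΨ c′ ⟨
      Φ (Ψ c′)  ∎)

    Ψ-isRPIso : IsRPIso N M J I Ψ
    Ψ-isRPIso = record
      { wd         = Ψ-wd
      ; injective  = λ {c} {c′} Ψc≈Ψc′ → begin-equality
                       c          ≈⟨ ΦΨ c ⟨
                       Φ (Ψ c)    ≈⟨ wd Ψc≈Ψc′ ⟩
                       Φ (Ψ c′)   ≈⟨ ΦΨ c′ ⟩
                       c′         ∎
      ; surjective = λ a → Φ a , ΨΦ a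
      ; pres-≤     = Ψ-mono
      ; refl-≤     = λ {c} {c′} Ψc≼Ψc′ → begin
                       c          ≈⟨ ΦΨ c ⟨
                       Φ (Ψ c)    ≤⟨ pres-≤ Ψc≼Ψc′ ⟩
                       Φ (Ψ c′)   ≈⟨ ΦΨ c′ ⟩
                       c′         ∎
      }

    IsGluing-pullback : ∀ {γ} → Cod.IsGluing γ → Dom.IsGluing (λ a b → Ψ (γ (Φ a) (Φ b)))
    IsGluing-pullback {γ} G = record
      { cong    = λ a≈a′ b≈b′ → Ψ-wd (cong (wd a≈a′) (wd b≈b′))
      ; idem    = λ a → Dom.≈ᵃ-trans (Ψ-wd (idem (Φ a))) (ΨΦ a)
      ; absorbˡ = λ a b c → Ψ-wd (Cod.≈ᵃ-trans (cong (ΦΨ _) (Cod.≈ᵃ-refl (Φ c)))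
                                               (absorbˡ (Φ a) (Φ b) (Φ c)))
      ; absorbʳ = λ a b c → Ψ-wd (Cod.≈ᵃ-trans (cong (Cod.≈ᵃ-refl (Φ a)) (ΦΨ _))
                                               (absorbʳ (Φ a) (Φ b) (Φ c)))
      ; mono    = λ a≼a′ b≼b′ → Ψ-mono (mono (pres-≤ a≼a′) (pres-≤ b≼b′))
      }
      where open Cod.IsGluing G

    ⊆⟦≡⟧-preserved : ∀ {p q} → p ≼ q → Dom.AE (λ n → p n ≢ q n) →
                     ∀ {x y u v} → ⟦ x ≡ y ⟧ ⊆ᵃ ⟦ u ≡ v ⟧ → ⟦ Φ x ≡ Φ y ⟧ ⊆ᵃ′ ⟦ Φ u ≡ Φ v ⟧
    ⊆⟦≡⟧-preserved {p} {q} p≼q p≢q {x} {y} {u} {v} x≡y⇒u≡v = Cod.glue≈ʳ⇒⊆ᵃ glue-Φu-Φv≈Φv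
      where
      T : Subset
      T = ⟦ Φ x ≡ Φ y ⟧
      γ : Prod M → Prod M → Prod M
      γ a b = Ψ (glue T (Φ a) (Φ b))
      G : Dom.IsGluing γ
      G = IsGluing-pullback (Cod.glue-isGluing T)
      γ≈glue : ∀ a b → γ a b ≈ glue (Dom.Interval.Split G p q) a b
      γ≈glue = Dom.IsGluing⇒≈glue G p≼q p≢q
      γxy≈y : γ x y ≈ y
      γxy≈y = Dom.≈ᵃ-trans (Ψ-wd (Cod.⊆ᵃ⇒glue≈ʳ (Cod.⊆⇒⊆ᵃ (λ Φx≡Φy → Φx≡Φy)))) (ΨΦ y)
      γuv≈v : γ u v ≈ v
      γuv≈v = Dom.≈ᵃ-trans (γ≈glue u v) (Dom.⊆ᵃ⇒glue≈ʳ
                (Dom.⊆ᵃ-trans (Dom.glue≈ʳ⇒⊆ᵃ (Dom.≈ᵃ-trans (Dom.≈ᵃ-sym (γ≈glue x y)) γxy≈y)) x≡y⇒u≡v))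
      glue-Φu-Φv≈Φv : glue T (Φ u) (Φ v) ≈′ Φ v
      glue-Φu-Φv≈Φv = Cod.≈ᵃ-trans (Cod.≈ᵃ-sym (ΦΨ _)) (wd γuv≈v)

  module OrderIsomorphism (I J : Pred Subset 0ℓ) (isI : IsIdeal I) (isJ : IsIdeal J) where
    module Dom = AlmostEverywhere I isI
    module Cod = AlmostEverywhere J isJ
    open Dom using (_⊆ᵃ_)
    open Cod using () renaming (_⊆ᵃ_ to _⊆ᵃ′_)

    module _ (α : Subset → Subset)
             (α-mono : ∀ {S T} → S ⊆ᵃ T → α S ⊆ᵃ′ α T)
             (α-reflect : ∀ {S T} → α S ⊆ᵃ′ α T → S ⊆ᵃ T)
             (α-onto : ∀ T → ∃[ S ] (α S ⊆ᵃ′ T × T ⊆ᵃ′ α S)) where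

      private
        preimage : Subset → Subset
        preimage T = proj₁ (α-onto T)

        α-preimage⊆ : ∀ T → α (preimage T) ⊆ᵃ′ T
        α-preimage⊆ T = proj₁ (proj₂ (α-onto T))

        ⊆α-preimage : ∀ T → T ⊆ᵃ′ α (preimage T)
        ⊆α-preimage T = proj₂ (proj₂ (α-onto T))

      α-∪-⊇ : ∀ S T → α S ∪ α T ⊆ᵃ′ α (S ∪ T)
      α-∪-⊇ S T = Cod.ae-map₂ (λ n → [_,_]) (α-mono (Dom.⊆⇒⊆ᵃ inj₁)) (α-mono (Dom.⊆⇒⊆ᵃ inj₂))

      α-∪-⊆ : ∀ S T → α (S ∪ T) ⊆ᵃ′ α S ∪ α T
      α-∪-⊆ S T = Cod.⊆ᵃ-trans (α-mono S∪T⊆V) (α-preimage⊆ (α S ∪ α T))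
        where
        V : Subset
        V = preimage (α S ∪ α T)
        S∪T⊆V : S ∪ T ⊆ᵃ V
        S∪T⊆V = Dom.ae-map₂ (λ n → [_,_])
                  (α-reflect (Cod.⊆ᵃ-trans (Cod.⊆⇒⊆ᵃ inj₁) (⊆α-preimage _)))
                  (α-reflect (Cod.⊆ᵃ-trans (Cod.⊆⇒⊆ᵃ inj₂) (⊆α-preimage _)))

      α-∅ : α ∅ ⊆ᵃ′ ∅
      α-∅ = Cod.⊆ᵃ-trans (α-mono (Dom.⊆⇒⊆ᵃ λ ())) (α-preimage⊆ ∅)

      α-∁-⊆ : ∀ S → α (∁ S) ⊆ᵃ′ ∁ (α S)
      α-∁-⊆ S = Cod.ae-map (λ n disjoint α∁S αS → disjoint (α∁S , αS))
                  (Cod.⊆ᵃ-trans (⊆α-preimage (α (∁ S) ∩ α S)) (Cod.⊆ᵃ-trans (α-mono V⊆∅) α-∅))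
        where
        V : Subset
        V = preimage (α (∁ S) ∩ α S)
        V⊆∅ : V ⊆ᵃ ∅
        V⊆∅ = Dom.ae-map₂ (λ n V⇒∁S V⇒S v → V⇒∁S v (V⇒S v))
                (α-reflect (Cod.⊆ᵃ-trans (α-preimage⊆ _) (Cod.⊆⇒⊆ᵃ proj₁)))
                (α-reflect (Cod.⊆ᵃ-trans (α-preimage⊆ _) (Cod.⊆⇒⊆ᵃ proj₂)))

      α-∁-⊇ : ∀ S → ∁ (α S) ⊆ᵃ′ α (∁ S)
      α-∁-⊇ S = Cod.ae-map (λ n covered ¬αS → [ ⊥-elim ∘ ¬αS , (λ α∁S → α∁S) ] (covered _))
                  (Cod.⊆ᵃ-trans (⊆α-preimage U)
                    (Cod.⊆ᵃ-trans (α-mono (Dom.⊆⇒⊆ᵃ excluded-middle)) (α-∪-⊆ S (∁ S))))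
        where
        excluded-middle : preimage U ⊆ S ∪ ∁ S
        excluded-middle {n} _ = by-cases (S n) inj₁ inj₂

      isBoolIso : IsBoolIso I J α
      isBoolIso = record
        { wd         = λ (S∖T , T∖S) → Cod.⊆ᵃ⇒⊑ (α-mono (Dom.⊑⇒⊆ᵃ S∖T)) , Cod.⊆ᵃ⇒⊑ (α-mono (Dom.⊑⇒⊆ᵃ T∖S))
        ; pres-∪     = λ S T → Cod.⊆ᵃ⇒⊑ (α-∪-⊆ S T) , Cod.⊆ᵃ⇒⊑ (α-∪-⊇ S T)
        ; pres-∁     = λ S → Cod.⊆ᵃ⇒⊑ (α-∁-⊆ S) , Cod.⊆ᵃ⇒⊑ (α-∁-⊇ S)
        ; injective  = λ (S∖T , T∖S) →
                         Dom.⊆ᵃ⇒⊑ (α-reflect (Cod.⊑⇒⊆ᵃ S∖T)) , Dom.⊆ᵃ⇒⊑ (α-reflect (Cod.⊑⇒⊆ᵃ T∖S))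
        ; surjective = λ T → preimage T , Cod.⊆ᵃ⇒⊑ (α-preimage⊆ T) , Cod.⊆ᵃ⇒⊑ (⊆α-preimage T)
        }

  module Recognition (I J : Pred Subset 0ℓ) (isI : IsIdeal I) (isJ : IsIdeal J)
                     (M N : ℕ → Structure)
                     (ramified-M : ∀ n → IsConnectedRamifiedSet (M n)) (two-M : ∀ n → AtLeastTwo (M n))
                     (ramified-N : ∀ n → IsConnectedRamifiedSet (N n)) (two-N : ∀ n → AtLeastTwo (N n))
                     (Φ : Prod M → Prod N) (iso : IsRPIso M N I J Φ) where
    open Isomorphism I J isI isJ M N ramified-M ramified-N Φ iso
    private module Inverse = Isomorphism J I isJ isI N M ramified-N ramified-M Ψ Ψ-isRPIso
    open Dom using (_⊆ᵃ_)
    open Cod using () renaming (_⊆ᵃ_ to _⊆ᵃ′_)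

    private
      pair-M : ∃[ p ] ∃[ q ] (p Dom.≼ q × Dom.AE (λ n → p n ≢ q n))
      pair-M = Dom.strictly-comparable-pair two-M

      pair-N : ∃[ p′ ] ∃[ q′ ] (p′ Cod.≼ q′ × Cod.AE (λ n → p′ n ≢ q′ n))
      pair-N = Cod.strictly-comparable-pair two-N

    p q : Prod M
    p = proj₁ pair-M
    q = proj₁ (proj₂ pair-M)

    q≢p : Dom.AE (λ n → q n ≢ p n)
    q≢p = Dom.ae-map (λ n p≢q q≡p → p≢q (sym q≡p)) (proj₂ (proj₂ (proj₂ pair-M)))

    preserved : ∀ {x y u v} → ⟦ x ≡ y ⟧ ⊆ᵃ ⟦ u ≡ v ⟧ → ⟦ Φ x ≡ Φ y ⟧ ⊆ᵃ′ ⟦ Φ u ≡ Φ v ⟧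
    preserved = ⊆⟦≡⟧-preserved (proj₁ (proj₂ (proj₂ pair-M))) (proj₂ (proj₂ (proj₂ pair-M)))

    reflected : ∀ {x y u v} → ⟦ Φ x ≡ Φ y ⟧ ⊆ᵃ′ ⟦ Φ u ≡ Φ v ⟧ → ⟦ x ≡ y ⟧ ⊆ᵃ ⟦ u ≡ v ⟧
    reflected {x} {y} {u} {v} Φx≡Φy⇒Φu≡Φv =
      Dom.⊆ᵃ-trans (Dom.⟦≡⟧-resp-≈ᵃ (Dom.≈ᵃ-sym (ΨΦ x)) (Dom.≈ᵃ-sym (ΨΦ y)))
        (Dom.⊆ᵃ-trans (Inverse.⊆⟦≡⟧-preserved (proj₁ (proj₂ (proj₂ pair-N))) (proj₂ (proj₂ (proj₂ pair-N)))
                                               Φx≡Φy⇒Φu≡Φv)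
                      (Dom.⟦≡⟧-resp-≈ᵃ (ΨΦ u) (ΨΦ v)))

    Φq≢Φp : Cod.AE (λ n → Φ q n ≢ Φ p n)
    Φq≢Φp = Cod.ae-map₂ (λ n Φq≡Φp⇒p′≡q′ p′≢q′ Φq≡Φp → p′≢q′ (Φq≡Φp⇒p′≡q′ Φq≡Φp))
              (Cod.⊆ᵃ-trans (preserved (Dom.ae-map (λ n q≢p q≡p → ⊥-elim (q≢p q≡p)) q≢p))
                            (Cod.⟦≡⟧-resp-≈ᵃ (ΦΨ p′) (ΦΨ q′)))
              (proj₂ (proj₂ (proj₂ pair-N)))
      where
      p′ q′ : Prod N
      p′ = proj₁ pair-N
      q′ = proj₁ (proj₂ pair-N)

    mark : Subset → Prod M
    mark S = glue S q p

    ⊆⟦mark≡q⟧ : ∀ S → S ⊆ᵃ ⟦ mark S ≡ q ⟧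
    ⊆⟦mark≡q⟧ S = Dom.⊆⇒⊆ᵃ glue-in

    ⟦mark≡q⟧⊆ : ∀ S → ⟦ mark S ≡ q ⟧ ⊆ᵃ S
    ⟦mark≡q⟧⊆ S = Dom.⟦glue≡ˡ⟧⊆ᵃ q≢p

    α : Subset → Subset
    α S = ⟦ Φ (mark S) ≡ Φ q ⟧

    α-mono : ∀ {S T} → S ⊆ᵃ T → α S ⊆ᵃ′ α T
    α-mono {S} {T} S⊆T = preserved (Dom.⊆ᵃ-trans (⟦mark≡q⟧⊆ S) (Dom.⊆ᵃ-trans S⊆T (⊆⟦mark≡q⟧ T)))

    α-reflect : ∀ {S T} → α S ⊆ᵃ′ α T → S ⊆ᵃ T
    α-reflect {S} {T} αS⊆αT = Dom.⊆ᵃ-trans (⊆⟦mark≡q⟧ S) (Dom.⊆ᵃ-trans (reflected αS⊆αT) (⟦mark≡q⟧⊆ T))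

    α-onto : ∀ T → ∃[ S ] (α S ⊆ᵃ′ T × T ⊆ᵃ′ α S)
    α-onto T = S , αS⊆T , T⊆αS
      where
      c : Prod N
      c = glue T (Φ q) (Φ p)
      S : Subset
      S = ⟦ Ψ c ≡ q ⟧
      αS⊆T : α S ⊆ᵃ′ T
      αS⊆T = Cod.⊆ᵃ-trans (preserved (⟦mark≡q⟧⊆ S))
               (Cod.⊆ᵃ-trans (Cod.⟦≡⟧-resp-≈ᵃ (ΦΨ c) (Cod.≈ᵃ-refl (Φ q)))
                             (Cod.⟦glue≡ˡ⟧⊆ᵃ Φq≢Φp))
      T⊆αS : T ⊆ᵃ′ α S
      T⊆αS = Cod.⊆ᵃ-trans (Cod.⊆⇒⊆ᵃ glue-in)
               (Cod.⊆ᵃ-trans (Cod.⟦≡⟧-resp-≈ᵃ (Cod.≈ᵃ-sym (ΦΨ c)) (Cod.≈ᵃ-refl (Φ q)))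
                             (preserved (⊆⟦mark≡q⟧ S)))

    coordinate-respecting : CoordinateRespecting M N I J Φ
    coordinate-respecting =
      α , OrderIsomorphism.isBoolIso I J isI isJ α α-mono α-reflect α-onto ,
      λ S a b a=b-on-S → Cod.⊆ᵃ⇒⊑ (preserved (Dom.⊆ᵃ-trans (⟦mark≡q⟧⊆ S) (Dom.⊑⇒⊆ᵃ a=b-on-S)))

proposition2p13 : ExcludedMiddle 0ℓ → RecognizesCoordinates IsConnectedRamifiedSet
proposition2p13 lem I J isI isJ _ _ M N ramified-M two-M ramified-N two-N Φ iso =
  Classical.Recognition.coordinate-respecting lem I J isI isJ M N ramified-M two-M ramified-N two-N Φ iso
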